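{- For all integers $m\ge 2$ and $n\ge 1$, the joint sum $F_m\boxplus P_n$ is Fibonacci cordial.
   Context: The Fibonacci numbers are defined by $F_0=0$, $F_1=F_2=1$, $F_n=F_{n-1}+F_{n-2}$. For a graph $G$ with $N$ vertices, a Fibonacci cordial labeling is an injective function $f:V(G)\to\{F_0,F_1,\dots,F_N\}$ (labels $F_i$ with distinct indices are regarded as distinct labels) such that the induced edge labeling $f^*(uv)=(f(u)+f(v)) \bmod 2$ satisfies $|\varepsilon_0-\varepsilon_1|\le 1$, where $\varepsilon_i$ is the number of edges labeled $i$. A graph admitting such a labeling is called Fibonacci cordial. Here $F_m$ (as a graph) denotes the fan: an apex vertex $u$ adjacent to every vertex of a path $u_1u_2\cdots u_m$. The joint sum $F_m\boxplus P_n$ is obtained from the fan $F_m$ and the path $P_n=v_1v_2\cdots v_n$ by adding the edge $uv_1$ joining the apex of the fan to an end vertex of the path. -}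

module Defs where

open import Data.Nat using (ℕ; zero; suc; _+_; _%_; _≤_; ∣_-_∣)
open import Data.Nat.Properties using (_≟_)
open import Data.Fin using (Fin; zero; suc; toℕ; inject₁; _↑ˡ_; _↑ʳ_)
open import Data.List using (List; []; _∷_; map; filter; length; _++_; allFin)
open import Data.Product using (_×_; _,_; Σ)
open import Function.Definitions using (Injective)
open import Relation.Binary.PropositionalEquality using (_≡_)

fib : ℕ → ℕ
fib zero = 0
fib (suc zero) = 1
fib (suc (suc n)) = fib (suc n) + fib n

record Graph : Set where
  field
    order : ℕ
    edges : List (Fin order × Fin order)

open Graph public

-- A labeling assigns to each vertex an index i ∈ {0,…,N}, i.e. the label F_i;
-- injectivity is on indices (F_1 and F_2 are regarded as distinct labels).
Labeling : Graph → Set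
Labeling G = Fin (order G) → Fin (suc (order G))

edgeLabel : (G : Graph) → Labeling G → Fin (order G) × Fin (order G) → ℕ
edgeLabel G f (a , b) = (fib (toℕ (f a)) + fib (toℕ (f b))) % 2

edgeCount : (G : Graph) → Labeling G → ℕ → ℕ
edgeCount G f i = length (filter (λ e → edgeLabel G f e ≟ i) (edges G))

IsFibonacciCordialLabeling : (G : Graph) → Labeling G → Set
IsFibonacciCordialLabeling G f =
  Injective _≡_ _≡_ f × ∣ edgeCount G f 0 - edgeCount G f 1 ∣ ≤ 1

FibonacciCordial : Graph → Set
FibonacciCordial G = Σ (Labeling G) (IsFibonacciCordialLabeling G)

pathEdges : (k : ℕ) → List (Fin k × Fin k)
pathEdges zero = []
pathEdges (suc k) = map (λ i → inject₁ i , suc i) (allFin k)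

mapEdges : {a b : ℕ} → (Fin a → Fin b) → List (Fin a × Fin a) → List (Fin b × Fin b)
mapEdges g = map (λ { (x , y) → g x , g y })

-- Vertex numbering of F_m ⊞ P_n (order 1 + m + n):
--   0 = apex u ;  1 + i = u_{i+1} (i < m) ;  1 + m + j = v_{j+1} (j < n)
apex : (m n : ℕ) → Fin (suc (m + n))
apex m n = zero

fanV : (m n : ℕ) → Fin m → Fin (suc (m + n))
fanV m n i = suc (i ↑ˡ n)

pathV : (m n : ℕ) → Fin n → Fin (suc (m + n))
pathV m n j = suc (m ↑ʳ j)

joinEdge : (m n : ℕ) → List (Fin (suc (m + n)) × Fin (suc (m + n)))
joinEdge m zero = []
joinEdge m (suc k) = (apex m (suc k) , pathV m (suc k) zero) ∷ []

fanJoinPath : ℕ → ℕ → Graph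
fanJoinPath m n = record
  { order = suc (m + n)
  ; edges =
         map (λ i → apex m n , fanV m n i) (allFin m)
      ++ mapEdges (fanV m n) (pathEdges m)
      ++ joinEdge m n
      ++ mapEdges (pathV m n) (pathEdges n)
  }

{-# OPTIONS --safe #-}
module Submission where

open import Defs
open import Data.Bool using (Bool; true; false; if_then_else_; _∨_; _∧_)
open import Data.Nat using (ℕ; zero; suc; _+_; _%_; _≤_; _<_; z≤n; s≤s; _<ᵇ_; _≡ᵇ_; ∣_-_∣)
open import Data.Nat.Properties using (_≟_; ≤-refl; ≤-trans; <⇒≤; ≤-pred; m≤n⇒m≤1+n; m≤n⇒m<n∨m≡n; <⇒≢; <-cmp; +-suc; +-comm; ∣-∣-comm)
open import Data.Nat.DivMod using (%-distribˡ-+; m%n<n)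
open import Data.Integer as ℤ using (ℤ; 0ℤ; 1ℤ; -1ℤ; _⊖_)
open import Data.Integer.Properties using (+-0-monoid; +-0-commutativeMonoid; +-assoc; +-identityˡ; +-identityʳ; [1+m]⊖[1+n]≡m⊖n; distribʳ-⊖-+-pos; distribʳ-⊖-+-neg)
open import Data.Integer.Tactic.RingSolver using (solve-∀)
open import Algebra.Properties.Monoid.Sum +-0-monoid using (sum-syntax; sum-init-last; sum-cong-≗)
open import Algebra.Properties.CommutativeMonoid.Sum +-0-commutativeMonoid using (∑-distrib-+)
open import Data.Fin as Fin using (Fin; toℕ; fromℕ<; inject₁)
open import Data.Fin.Properties using (toℕ-fromℕ<; toℕ<n; toℕ-injective; toℕ-↑ˡ; toℕ-↑ʳ; toℕ-inject₁; toℕ-fromℕ)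
open import Data.List using (List; []; _∷_; _++_; map; filter; length; tabulate; allFin)
open import Data.List.Properties using (map-tabulate; map-∘)
open import Data.Product using (_×_; _,_)
open import Data.Sum using (inj₁; inj₂)
open import Function using (id; _∘_)
open import Function.Definitions using (Injective)
open import Relation.Nullary using (contradiction)
open import Relation.Binary.Definitions using (tri<; tri≈; tri>)
open import Relation.Binary.PropositionalEquality
open ≡-Reasoning

-- Label the vertices in the order u, u₁, …, u_m, v₁, …, v_n: vertex k takes its fresh index
-- k + 1, or instead the index held in a one-place buffer (initially 0), which k + 1 then
-- replaces; any such labelling is injective into {0, …, N}.  Choose greedily: whichever
-- leaves the running imbalance ε₁ − ε₀ smaller in absolute value, avoiding an even fresh
-- index on a tie.  Only parities matter, and the parities of the Fibonacci numbers obey the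
-- Fibonacci recurrence mod 2, so the greedy walk is a finite automaton: on the fan it runs
-- through a 3-cycle, on the path through a 12-cycle on which the imbalance stays in {−1, 0, 1}.

fibParity : ℕ → ℕ
fibParity k = fib k % 2

fibParity-step : ∀ k → fibParity (suc (suc k)) ≡ (fibParity (suc k) + fibParity k) % 2
fibParity-step k = %-distribˡ-+ (fib (suc k)) (fib k) 2

labelSign : ℕ → ℤ
labelSign zero    = -1ℤ
labelSign (suc _) = 1ℤ

paritySign : ℕ → ℕ → ℤ
paritySign p q = labelSign ((p + q) % 2)

data BackEdges : Set where
  noBackEdges toApex toApexAndPrevious toPrevious : BackEdges

-- What the greedy rule sees at vertex k: the running imbalance and the parities of the
-- previous label, of the buffered index and of the fresh indices k + 1 and k + 2.
record Snapshot : Set where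
  constructor ⟨_,_,_,_,_⟩
  field
    balance  : ℤ
    previous : ℕ
    buffered : ℕ
    fresh    : ℕ
    fresh′   : ℕ
open Snapshot

-- The apex always keeps its fresh label F₁, whose parity is 1.
gain : BackEdges → Snapshot → ℕ → ℤ
gain noBackEdges       s p = 0ℤ
gain toApex            s p = paritySign 1 p
gain toApexAndPrevious s p = paritySign 1 p ℤ.+ paritySign (previous s) p
gain toPrevious        s p = paritySign (previous s) p

takesBuffered : BackEdges → Snapshot → Bool
takesBuffered e s = (ℤ.∣ withBuffered ∣ <ᵇ ℤ.∣ withFresh ∣)
                  ∨ ((ℤ.∣ withBuffered ∣ ≡ᵇ ℤ.∣ withFresh ∣) ∧ (fresh s ≡ᵇ 0))
  where
  withBuffered = balance s ℤ.+ gain e s (buffered s)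
  withFresh    = balance s ℤ.+ gain e s (fresh s)

move : Bool → BackEdges → Snapshot → Snapshot
move t e s = ⟨ balance s ℤ.+ gain e s p , p , b , fresh′ s , (fresh′ s + fresh s) % 2 ⟩
  where
  p = if t then buffered s else fresh s
  b = if t then fresh s else buffered s

advance : BackEdges → Snapshot → Snapshot
advance e s = move (takesBuffered e s) e s

data OnFanCycle : Snapshot → Set where
  fan₀ : OnFanCycle ⟨ -1ℤ , 1 , 0 , 0 , 1 ⟩
  fan₁ : OnFanCycle ⟨ 1ℤ  , 0 , 0 , 1 , 1 ⟩
  fan₂ : OnFanCycle ⟨ 1ℤ  , 1 , 0 , 1 , 0 ⟩

data OnPathCycle : Snapshot → Set where
  path₀  : OnPathCycle ⟨ 0ℤ  , 0 , 0 , 1 , 1 ⟩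
  path₁  : OnPathCycle ⟨ 1ℤ  , 1 , 0 , 1 , 0 ⟩
  path₂  : OnPathCycle ⟨ 0ℤ  , 1 , 0 , 0 , 1 ⟩
  path₃  : OnPathCycle ⟨ 1ℤ  , 0 , 0 , 1 , 1 ⟩
  path₄  : OnPathCycle ⟨ 0ℤ  , 0 , 1 , 1 , 0 ⟩
  path₅  : OnPathCycle ⟨ 1ℤ  , 1 , 1 , 0 , 1 ⟩
  path₆  : OnPathCycle ⟨ 0ℤ  , 1 , 0 , 1 , 1 ⟩
  path₇  : OnPathCycle ⟨ -1ℤ , 1 , 0 , 1 , 0 ⟩
  path₈  : OnPathCycle ⟨ 0ℤ  , 0 , 1 , 0 , 1 ⟩
  path₉  : OnPathCycle ⟨ 1ℤ  , 1 , 0 , 1 , 1 ⟩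
  path₁₀ : OnPathCycle ⟨ 0ℤ  , 1 , 0 , 1 , 0 ⟩
  path₁₁ : OnPathCycle ⟨ -1ℤ , 1 , 0 , 0 , 1 ⟩

fan-advance : ∀ {s} → OnFanCycle s → OnFanCycle (advance toApexAndPrevious s)
fan-advance fan₀ = fan₁
fan-advance fan₁ = fan₂
fan-advance fan₂ = fan₀

join-advance : ∀ {s} → OnFanCycle s → OnPathCycle (advance toApex s)
join-advance fan₀ = path₀
join-advance fan₁ = path₁₀
join-advance fan₂ = path₂

path-advance : ∀ {s} → OnPathCycle s → OnPathCycle (advance toPrevious s)
path-advance path₀  = path₁
path-advance path₁  = path₂
path-advance path₂  = path₃
path-advance path₃  = path₄
path-advance path₄  = path₅
path-advance path₅  = path₆
path-advance path₆  = path₇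
path-advance path₇  = path₈
path-advance path₈  = path₉
path-advance path₉  = path₁₀
path-advance path₁₀ = path₁₁
path-advance path₁₁ = path₀

∣balance∣≤1 : ∀ {s} → OnPathCycle s → ℤ.∣ balance s ∣ ≤ 1
∣balance∣≤1 path₀  = z≤n
∣balance∣≤1 path₁  = s≤s z≤n
∣balance∣≤1 path₂  = z≤n
∣balance∣≤1 path₃  = s≤s z≤n
∣balance∣≤1 path₄  = z≤n
∣balance∣≤1 path₅  = s≤s z≤n
∣balance∣≤1 path₆  = z≤n
∣balance∣≤1 path₇  = s≤s z≤n
∣balance∣≤1 path₈  = z≤n
∣balance∣≤1 path₉  = s≤s z≤n
∣balance∣≤1 path₁₀ = z≤n
∣balance∣≤1 path₁₁ = s≤s z≤n

module BufferedEnumeration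
  (takesBuffer : ℕ → Bool) (buffer : ℕ → ℕ)
  (buffer-zero : buffer 0 ≡ 0)
  (buffer-suc : ∀ k → buffer (suc k) ≡ (if takesBuffer k then suc k else buffer k))
  where

  label : ℕ → ℕ
  label k = if takesBuffer k then buffer k else suc k

  buffer≤ : ∀ k → buffer k ≤ k
  buffer≤ zero rewrite buffer-zero = z≤n
  buffer≤ (suc k) rewrite buffer-suc k with takesBuffer k
  ... | true  = ≤-refl
  ... | false = m≤n⇒m≤1+n (buffer≤ k)

  label≤ : ∀ k → label k ≤ suc k
  label≤ k with takesBuffer k
  ... | true  = m≤n⇒m≤1+n (buffer≤ k)
  ... | false = ≤-refl

  label≢fresh : ∀ {i k} → i < k → label i ≢ suc k
  label≢fresh i<k = <⇒≢ (s≤s (≤-trans (label≤ _) i<k))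

  label≢buffer : ∀ {i} k → i < k → label i ≢ buffer k
  label≢buffer {i} (suc k) i<1+k with m≤n⇒m<n∨m≡n (≤-pred i<1+k)
  ... | inj₁ i<k rewrite buffer-suc k with takesBuffer k
  ...   | true  = label≢fresh i<k
  ...   | false = label≢buffer k i<k
  label≢buffer {i} (suc i) _ | inj₂ refl rewrite buffer-suc i with takesBuffer i
  ...   | true  = <⇒≢ (s≤s (buffer≤ i))
  ...   | false = <⇒≢ (s≤s (buffer≤ i)) ∘ sym

  label≢ : ∀ {i j} → i < j → label i ≢ label j
  label≢ {j = j} i<j with takesBuffer j
  ... | true  = label≢buffer j i<j
  ... | false = label≢fresh i<j

  label-injective : ∀ {i j} → label i ≡ label j → i ≡ j
  label-injective {i} {j} eq with <-cmp i j
  ... | tri< i<j _ _ = contradiction eq (label≢ i<j)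
  ... | tri≈ _ i≡j _ = i≡j
  ... | tri> _ _ j<i = contradiction (sym eq) (label≢ j<i)

module _ {X : Set} (ℓ : X → ℕ) where

  count : ℕ → List X → ℕ
  count c xs = length (filter (λ x → ℓ x ≟ c) xs)

  imbalance : List X → ℤ
  imbalance []       = 0ℤ
  imbalance (x ∷ xs) = labelSign (ℓ x) ℤ.+ imbalance xs

  imbalance-++ : ∀ xs ys → imbalance (xs ++ ys) ≡ imbalance xs ℤ.+ imbalance ys
  imbalance-++ []       ys = sym (+-identityˡ (imbalance ys))
  imbalance-++ (x ∷ xs) ys =
    trans (cong (λ z → labelSign (ℓ x) ℤ.+ z) (imbalance-++ xs ys))
          (sym (+-assoc (labelSign (ℓ x)) _ _))

  imbalance-tabulate : ∀ {k} (h : Fin k → X) →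
                       imbalance (tabulate h) ≡ ∑[ i < k ] labelSign (ℓ (h i))
  imbalance-tabulate {zero}  h = refl
  imbalance-tabulate {suc k} h =
    cong (λ z → labelSign (ℓ (h Fin.zero)) ℤ.+ z) (imbalance-tabulate (h ∘ Fin.suc))

  count₁⊖count₀≡imbalance : (∀ x → ℓ x < 2) → ∀ xs → count 1 xs ⊖ count 0 xs ≡ imbalance xs
  count₁⊖count₀≡imbalance ℓ<2 []       = refl
  count₁⊖count₀≡imbalance ℓ<2 (x ∷ xs) with ℓ x | ℓ<2 x
  ... | 0 | _ = trans (sym (distribʳ-⊖-+-neg 0 (count 1 xs) (count 0 xs)))
                      (cong (λ z → -1ℤ ℤ.+ z) (count₁⊖count₀≡imbalance ℓ<2 xs))
  ... | 1 | _ = trans (sym (distribʳ-⊖-+-pos 1 (count 1 xs) (count 0 xs)))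
                      (cong (λ z → 1ℤ ℤ.+ z) (count₁⊖count₀≡imbalance ℓ<2 xs))
  ... | suc (suc _) | s≤s (s≤s ())

∣m-n∣≡∣m⊖n∣ : ∀ m n → ∣ m - n ∣ ≡ ℤ.∣ m ⊖ n ∣
∣m-n∣≡∣m⊖n∣ zero    zero    = refl
∣m-n∣≡∣m⊖n∣ zero    (suc n) = refl
∣m-n∣≡∣m⊖n∣ (suc m) zero    = refl
∣m-n∣≡∣m⊖n∣ (suc m) (suc n) = trans (∣m-n∣≡∣m⊖n∣ m n) (cong ℤ.∣_∣ (sym ([1+m]⊖[1+n]≡m⊖n m n)))

∑-snoc : (g : ℕ → ℤ) (k : ℕ) → ∑[ i < suc k ] g (toℕ i) ≡ ∑[ i < k ] g (toℕ i) ℤ.+ g k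
∑-snoc g k = trans (sum-init-last {k} (g ∘ toℕ))
  (cong₂ ℤ._+_ (sum-cong-≗ {k} (cong g ∘ toℕ-inject₁)) (cong g (toℕ-fromℕ k)))

telescope : (b g : ℕ → ℤ) (k : ℕ) → (∀ i → i < k → b (suc i) ≡ b i ℤ.+ g i) →
            b k ≡ b 0 ℤ.+ ∑[ i < k ] g (toℕ i)
telescope b g zero    step = sym (+-identityʳ (b 0))
telescope b g (suc k) step = begin
  b (suc k)                               ≡⟨ step k ≤-refl ⟩
  b k ℤ.+ g k                             ≡⟨ cong (λ z → z ℤ.+ g k) (telescope b g k (λ i → step i ∘ m≤n⇒m≤1+n)) ⟩
  b 0 ℤ.+ ∑[ i < k ] g (toℕ i) ℤ.+ g k    ≡⟨ +-assoc (b 0) _ _ ⟩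
  b 0 ℤ.+ (∑[ i < k ] g (toℕ i) ℤ.+ g k)  ≡⟨ cong (λ z → b 0 ℤ.+ z) (∑-snoc g k) ⟨
  b 0 ℤ.+ ∑[ i < suc k ] g (toℕ i)        ∎

-- backEdges m k: the edges from vertex k of fanJoinPath (1 + m) n to earlier vertices;
-- backEdges₂₊ m i is backEdges m (2 + i).
backEdges₂₊ : ℕ → ℕ → BackEdges
backEdges₂₊ zero    zero    = toApex
backEdges₂₊ zero    (suc i) = toPrevious
backEdges₂₊ (suc m) zero    = toApexAndPrevious
backEdges₂₊ (suc m) (suc i) = backEdges₂₊ m i

backEdges : ℕ → ℕ → BackEdges
backEdges m zero          = noBackEdges
backEdges m (suc zero)    = toApex
backEdges m (suc (suc i)) = backEdges₂₊ m i

backEdges-fan : ∀ {m i} → i < m → backEdges m (2 + i) ≡ toApexAndPrevious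
backEdges-fan {suc m} {zero}  _         = refl
backEdges-fan {suc m} {suc i} (s≤s i<m) = backEdges-fan i<m

backEdges-join : ∀ m → backEdges m (2 + m) ≡ toApex
backEdges-join zero    = refl
backEdges-join (suc m) = backEdges-join m

backEdges-path : ∀ m j → backEdges m (3 + (j + m)) ≡ toPrevious
backEdges-path zero    j = refl
backEdges-path (suc m) j rewrite +-suc j m = backEdges-path m j

record Walk : Set where
  constructor walk
  field
    bufferIndex    : ℕ
    lastIndex      : ℕ
    runningBalance : ℤ
open Walk

snapshot : ℕ → Walk → Snapshot
snapshot k w = ⟨ runningBalance w , fibParity (lastIndex w) , fibParity (bufferIndex w) ,
                 fibParity (suc k) , fibParity (suc (suc k)) ⟩

walkMove : Bool → BackEdges → ℕ → Walk → Walk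
walkMove t e k w = walk (if t then suc k else bufferIndex w) (if t then bufferIndex w else suc k)
                        (balance (move t e (snapshot k w)))

snapshot-walkMove : ∀ t e k w → snapshot (suc k) (walkMove t e k w) ≡ move t e (snapshot k w)
snapshot-walkMove true e k w =
  cong ⟨ balance (move true e (snapshot k w)) , fibParity (bufferIndex w) , fibParity (suc k) ,
         fibParity (suc (suc k)) ,_⟩
       (fibParity-step (suc k))
snapshot-walkMove false e k w =
  cong ⟨ balance (move false e (snapshot k w)) , fibParity (suc k) , fibParity (bufferIndex w) ,
         fibParity (suc (suc k)) ,_⟩
       (fibParity-step (suc k))

module GreedyLabelling (m : ℕ) where

  walkAt : ℕ → Walk
  takes : ℕ → Bool
  walkAt zero    = walk 0 0 0ℤ
  walkAt (suc k) = walkMove (takes k) (backEdges m k) k (walkAt k)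
  takes k = takesBuffered (backEdges m k) (snapshot k (walkAt k))

  open BufferedEnumeration takes (bufferIndex ∘ walkAt) refl (λ _ → refl) public

  balanceAt : ℕ → ℤ
  balanceAt k = runningBalance (walkAt k)

  edgeSign : ℕ → ℕ → ℤ
  edgeSign x y = paritySign (fibParity (label x)) (fibParity (label y))

  snapshot-step : ∀ {k e} → backEdges m k ≡ e →
                  snapshot (suc k) (walkAt (suc k)) ≡ advance e (snapshot k (walkAt k))
  snapshot-step {k} refl = snapshot-walkMove (takes k) (backEdges m k) k (walkAt k)

  balance-step : ∀ {k e} → backEdges m k ≡ e →
                 balanceAt (suc k) ≡ balanceAt k ℤ.+ gain e (snapshot k (walkAt k)) (fibParity (label k))
  balance-step {k} {e} eq =
    trans (cong balance (snapshot-step {k} eq))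
          (cong (λ p → balanceAt k ℤ.+ gain e (snapshot k (walkAt k)) p)
                (cong previous (sym (snapshot-step {k} eq))))

  -- The apex takes F₁ and u₁ takes F₂, leaving F₀ in the buffer.
  fan-snapshots : ∀ k → k ≤ m → OnFanCycle (snapshot (2 + k) (walkAt (2 + k)))
  fan-snapshots zero    _   = fan₀
  fan-snapshots (suc k) k<m =
    subst OnFanCycle (sym (snapshot-step (backEdges-fan k<m)))
          (fan-advance (fan-snapshots k (<⇒≤ k<m)))

  path-snapshots : ∀ j → OnPathCycle (snapshot (3 + (j + m)) (walkAt (3 + (j + m))))
  path-snapshots zero    =
    subst OnPathCycle (sym (snapshot-step (backEdges-join m))) (join-advance (fan-snapshots m ≤-refl))
  path-snapshots (suc j) =
    subst OnPathCycle (sym (snapshot-step (backEdges-path m j))) (path-advance (path-snapshots j))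

  fan-balance : balanceAt (2 + m) ≡
                edgeSign 0 1 ℤ.+ ∑[ i < m ] (edgeSign 0 (2 + toℕ i) ℤ.+ edgeSign (1 + toℕ i) (2 + toℕ i))
  fan-balance = telescope (λ i → balanceAt (2 + i))
                          (λ i → edgeSign 0 (2 + i) ℤ.+ edgeSign (1 + i) (2 + i)) m
                          (λ i i<m → balance-step (backEdges-fan i<m))

  join-balance : balanceAt (3 + m) ≡ balanceAt (2 + m) ℤ.+ edgeSign 0 (2 + m)
  join-balance = balance-step (backEdges-join m)

  path-balance : ∀ n → balanceAt (3 + (n + m)) ≡
                 balanceAt (3 + m) ℤ.+ ∑[ j < n ] edgeSign (2 + (toℕ j + m)) (3 + (toℕ j + m))
  path-balance n = telescope (λ j → balanceAt (3 + (j + m)))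
                             (λ j → edgeSign (2 + (j + m)) (3 + (j + m))) n
                             (λ j _ → balance-step (backEdges-path m j))

module _ (m n : ℕ) where
  open GreedyLabelling m

  G : Graph
  G = fanJoinPath (suc m) (suc n)

  label<N+1 : ∀ (v : Fin (order G)) → label (toℕ v) < suc (order G)
  label<N+1 v = s≤s (≤-trans (label≤ (toℕ v)) (toℕ<n v))

  greedyLabelling : Labeling G
  greedyLabelling v = fromℕ< (label<N+1 v)

  toℕ-greedyLabelling : ∀ v → toℕ (greedyLabelling v) ≡ label (toℕ v)
  toℕ-greedyLabelling v = toℕ-fromℕ< (label<N+1 v)

  greedyLabelling-injective : Injective _≡_ _≡_ greedyLabelling
  greedyLabelling-injective {x} {y} eq = toℕ-injective (label-injective (begin
    label (toℕ x)           ≡⟨ toℕ-greedyLabelling x ⟨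
    toℕ (greedyLabelling x) ≡⟨ cong toℕ eq ⟩
    toℕ (greedyLabelling y) ≡⟨ toℕ-greedyLabelling y ⟩
    label (toℕ y)           ∎))

  ℓ : Fin (order G) × Fin (order G) → ℕ
  ℓ = edgeLabel G greedyLabelling

  ℓ-parity : ∀ x y → ℓ (x , y) ≡ (fibParity (label (toℕ x)) + fibParity (label (toℕ y))) % 2
  ℓ-parity x y =
    trans (cong₂ (λ p q → (fib p + fib q) % 2) (toℕ-greedyLabelling x) (toℕ-greedyLabelling y))
          (%-distribˡ-+ (fib (label (toℕ x))) (fib (label (toℕ y))) 2)

  imbalance-edges : ∀ {k} (x y : Fin k → Fin (order G)) →
    imbalance ℓ (map (λ i → x i , y i) (allFin k)) ≡ ∑[ i < k ] edgeSign (toℕ (x i)) (toℕ (y i))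
  imbalance-edges {k} x y = begin
    imbalance ℓ (map (λ i → x i , y i) (allFin k))
      ≡⟨ cong (imbalance ℓ) (map-tabulate id (λ i → x i , y i)) ⟩
    imbalance ℓ (tabulate (λ i → x i , y i))
      ≡⟨ imbalance-tabulate ℓ (λ i → x i , y i) ⟩
    ∑[ i < k ] labelSign (ℓ (x i , y i))
      ≡⟨ sum-cong-≗ {k} (λ i → cong labelSign (ℓ-parity (x i) (y i))) ⟩
    ∑[ i < k ] edgeSign (toℕ (x i)) (toℕ (y i)) ∎

  imbalance-pathEdges : ∀ {k} (v : Fin (suc k) → Fin (order G)) →
    imbalance ℓ (mapEdges v (pathEdges (suc k))) ≡ ∑[ i < k ] edgeSign (toℕ (v (inject₁ i))) (toℕ (v (Fin.suc i)))
  imbalance-pathEdges {k} v =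
    trans (cong (imbalance ℓ) (sym (map-∘ (allFin k)))) (imbalance-edges (v ∘ inject₁) (v ∘ Fin.suc))

  toℕ-fanV : ∀ i → toℕ (fanV (suc m) (suc n) i) ≡ suc (toℕ i)
  toℕ-fanV i = cong suc (toℕ-↑ˡ i (suc n))

  toℕ-pathV : ∀ j → toℕ (pathV (suc m) (suc n) j) ≡ 2 + (toℕ j + m)
  toℕ-pathV j = cong suc (trans (toℕ-↑ʳ (suc m) j) (cong suc (+-comm m (toℕ j))))

  spokes rim join path : List (Fin (order G) × Fin (order G))
  spokes = map (λ i → apex (suc m) (suc n) , fanV (suc m) (suc n) i) (allFin (suc m))
  rim    = mapEdges (fanV (suc m) (suc n)) (pathEdges (suc m))
  join   = joinEdge (suc m) (suc n)
  path   = mapEdges (pathV (suc m) (suc n)) (pathEdges (suc n))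

  spokes-imbalance : imbalance ℓ spokes ≡ edgeSign 0 1 ℤ.+ ∑[ i < m ] edgeSign 0 (2 + toℕ i)
  spokes-imbalance = trans (imbalance-edges (λ _ → apex (suc m) (suc n)) (fanV (suc m) (suc n)))
                           (sum-cong-≗ {suc m} (cong (edgeSign 0) ∘ toℕ-fanV))

  rim-imbalance : imbalance ℓ rim ≡ ∑[ i < m ] edgeSign (1 + toℕ i) (2 + toℕ i)
  rim-imbalance = trans (imbalance-pathEdges (fanV (suc m) (suc n)))
    (sum-cong-≗ {m} (λ i → cong₂ edgeSign (trans (toℕ-fanV (inject₁ i)) (cong suc (toℕ-inject₁ i)))
                                          (toℕ-fanV (Fin.suc i))))

  join-imbalance : imbalance ℓ join ≡ edgeSign 0 (2 + m)
  join-imbalance =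
    trans (imbalance-edges {1} (λ _ → apex (suc m) (suc n)) (λ _ → pathV (suc m) (suc n) Fin.zero))
          (trans (+-identityʳ _) (cong (edgeSign 0) (toℕ-pathV Fin.zero)))

  path-imbalance : imbalance ℓ path ≡ ∑[ j < n ] edgeSign (2 + (toℕ j + m)) (3 + (toℕ j + m))
  path-imbalance = trans (imbalance-pathEdges (pathV (suc m) (suc n)))
    (sum-cong-≗ {n} (λ j → cong₂ edgeSign (trans (toℕ-pathV (inject₁ j)) (cong (λ t → 2 + (t + m)) (toℕ-inject₁ j)))
                                          (toℕ-pathV (Fin.suc j))))

  edges-imbalance : imbalance ℓ (edges G) ≡ balanceAt (3 + (n + m))
  edges-imbalance = begin
    imbalance ℓ (spokes ++ rim ++ join ++ path)
      ≡⟨ imbalance-++ ℓ spokes _ ⟩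
    imbalance ℓ spokes ℤ.+ imbalance ℓ (rim ++ join ++ path)
      ≡⟨ cong (λ z → imbalance ℓ spokes ℤ.+ z)
              (trans (imbalance-++ ℓ rim _) (cong (λ z → imbalance ℓ rim ℤ.+ z) (imbalance-++ ℓ join path))) ⟩
    imbalance ℓ spokes ℤ.+ (imbalance ℓ rim ℤ.+ (imbalance ℓ join ℤ.+ imbalance ℓ path))
      ≡⟨ cong₂ ℤ._+_ spokes-imbalance (cong₂ ℤ._+_ rim-imbalance (cong₂ ℤ._+_ join-imbalance path-imbalance)) ⟩
    (edgeSign 0 1 ℤ.+ ∑[ i < m ] a i) ℤ.+ (∑[ i < m ] r i ℤ.+ (edgeSign 0 (2 + m) ℤ.+ P))
      ≡⟨ regroup (edgeSign 0 1) (∑[ i < m ] a i) (∑[ i < m ] r i) (edgeSign 0 (2 + m)) P ⟩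
    ((edgeSign 0 1 ℤ.+ (∑[ i < m ] a i ℤ.+ ∑[ i < m ] r i)) ℤ.+ edgeSign 0 (2 + m)) ℤ.+ P
      ≡⟨ cong (λ z → ((edgeSign 0 1 ℤ.+ z) ℤ.+ edgeSign 0 (2 + m)) ℤ.+ P) (∑-distrib-+ a r) ⟨
    ((edgeSign 0 1 ℤ.+ ∑[ i < m ] (a i ℤ.+ r i)) ℤ.+ edgeSign 0 (2 + m)) ℤ.+ P
      ≡⟨ cong (λ z → (z ℤ.+ edgeSign 0 (2 + m)) ℤ.+ P) fan-balance ⟨
    (balanceAt (2 + m) ℤ.+ edgeSign 0 (2 + m)) ℤ.+ P
      ≡⟨ cong (λ z → z ℤ.+ P) join-balance ⟨
    balanceAt (3 + m) ℤ.+ P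
      ≡⟨ path-balance n ⟨
    balanceAt (3 + (n + m)) ∎
    where
    a r : Fin m → ℤ
    a i = edgeSign 0 (2 + toℕ i)
    r i = edgeSign (1 + toℕ i) (2 + toℕ i)
    P = ∑[ j < n ] edgeSign (2 + (toℕ j + m)) (3 + (toℕ j + m))
    regroup : ∀ s x y j p → (s ℤ.+ x) ℤ.+ (y ℤ.+ (j ℤ.+ p)) ≡ ((s ℤ.+ (x ℤ.+ y)) ℤ.+ j) ℤ.+ p
    regroup = solve-∀

  greedyLabelling-balanced : ∣ edgeCount G greedyLabelling 0 - edgeCount G greedyLabelling 1 ∣ ≤ 1
  greedyLabelling-balanced = subst (_≤ 1) (sym distance) (∣balance∣≤1 (path-snapshots n))
    where
    ε₀ ε₁ : ℕ
    ε₀ = edgeCount G greedyLabelling 0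
    ε₁ = edgeCount G greedyLabelling 1
    ℓ<2 : ∀ e → ℓ e < 2
    ℓ<2 (x , y) = m%n<n (fib (toℕ (greedyLabelling x)) + fib (toℕ (greedyLabelling y))) 2
    distance : ∣ ε₀ - ε₁ ∣ ≡ ℤ.∣ balanceAt (3 + (n + m)) ∣
    distance = begin
      ∣ ε₀ - ε₁ ∣                   ≡⟨ ∣-∣-comm ε₀ ε₁ ⟩
      ∣ ε₁ - ε₀ ∣                   ≡⟨ ∣m-n∣≡∣m⊖n∣ ε₁ ε₀ ⟩
      ℤ.∣ ε₁ ⊖ ε₀ ∣                 ≡⟨ cong ℤ.∣_∣ (count₁⊖count₀≡imbalance ℓ ℓ<2 (edges G)) ⟩
      ℤ.∣ imbalance ℓ (edges G) ∣   ≡⟨ cong ℤ.∣_∣ edges-imbalance ⟩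
      ℤ.∣ balanceAt (3 + (n + m)) ∣ ∎

fanJoinPath-fibonacciCordial : ∀ m n → FibonacciCordial (fanJoinPath (suc m) (suc n))
fanJoinPath-fibonacciCordial m n =
  greedyLabelling m n , greedyLabelling-injective m n , greedyLabelling-balanced m n

mainTheorem5 : (m n : ℕ) → 2 ≤ m → 1 ≤ n → FibonacciCordial (fanJoinPath m n)
mainTheorem5 (suc (suc m)) (suc n) (s≤s (s≤s z≤n)) (s≤s z≤n) = fanJoinPath-fibonacciCordial (suc m) n
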